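{- Let $\Gamma$ be a vertex-transitive graph and let $C$ be a clique of $\Gamma$. Then $C$ is a strong clique if and only if $|C|\cdot|I|=|V(\Gamma)|$ for every maximal independent set $I$ of $\Gamma$.
   Context: All graphs are finite and simple. A clique is a set of pairwise adjacent vertices, an independent set a set of pairwise non-adjacent vertices; "maximal" means inclusion-maximal. A clique is called strong if it intersects every maximal independent set of the graph. A graph is vertex-transitive if its automorphism group acts transitively on its vertex set. -}

module Defs where

open import Data.Nat using (ℕ)
open import Data.Fin using (Fin)
open import Data.Fin.Subset using (Subset; _∈_; _∉_; _⊆_)
open import Data.Product using (Σ; ∃; _×_)
open import Data.Empty using (⊥)
open import Relation.Nullary using (¬_)
open import Relation.Binary.PropositionalEquality using (_≡_)
open import Function.Bundles using (_↔_; Inverse)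

record Graph (n : ℕ) : Set₁ where
  field
    Adj     : Fin n → Fin n → Set
    sym     : ∀ {u v} → Adj u v → Adj v u
    irrefl  : ∀ {u} → ¬ Adj u u

module _ {n : ℕ} (G : Graph n) where
  open Graph G

  IsClique : Subset n → Set
  IsClique C = ∀ {u v} → u ∈ C → v ∈ C → ¬ (u ≡ v) → Adj u v

  IsIndependent : Subset n → Set
  IsIndependent I = ∀ {u v} → u ∈ I → v ∈ I → ¬ Adj u v

  IsMaximalIndependent : Subset n → Set
  IsMaximalIndependent I =
    IsIndependent I × (∀ J → IsIndependent J → I ⊆ J → J ⊆ I)

  IsStrongClique : Subset n → Set
  IsStrongClique C =
    IsClique C × (∀ I → IsMaximalIndependent I → ∃ λ v → v ∈ C × v ∈ I)

  IsAutomorphism : (Fin n ↔ Fin n) → Set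
  IsAutomorphism σ = ∀ u v → (Adj u v → Adj (f u) (f v)) × (Adj (f u) (f v) → Adj u v)
    where open Inverse σ renaming (to to f)

  IsVertexTransitive : Set
  IsVertexTransitive =
    ∀ u v → Σ (Fin n ↔ Fin n) λ σ → IsAutomorphism σ × Inverse.to σ u ≡ v

-- Count the pairs (σ, c) with σ an automorphism, c ∈ C and σ c ∈ I. By vertex-transitivity every
-- vertex is sent to every other by exactly |Aut|/n automorphisms, so there are |C| |I| |Aut| / n
-- such pairs. Each σ maps the clique C to a clique, which meets the independent set I at most once;
-- if C is strong and I maximal it meets I exactly once, since σ⁻¹ I is again maximal independent.
-- Hence |C| |I| = n. Conversely, if |C| |I| = n then every σ must contribute exactly one pair,
-- in particular the identity, so C meets I.
module Submission where

open import Defs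
open import Data.Nat using (ℕ; _*_; NonZero)
open import Data.Fin.Subset using (Subset; ∣_∣)
open import Data.Product using (_×_)
open import Relation.Binary.PropositionalEquality using (_≡_)

open import Data.Nat using (zero; suc; _+_; _^_; _≤_; _<_; z≤n; s≤s; >-nonZero) renaming (_≟_ to _≟ℕ_)
open import Data.Nat.Properties
  using ( +-*-semiring; +-mono-≤; +-mono-<-≤; +-mono-≤-<; m≤m+n; m≤n+m; ≤-trans; ≤-reflexive; ≤-antisym; <⇒≢
        ; +-identityʳ; *-identityʳ; *-zeroʳ; *-assoc; *-cancelʳ-≡; *-cancelˡ-≡)
open import Data.Nat.Tactic.RingSolver using (solve-∀)
open import Data.Fin.Base using (Fin; zero; suc; combine; finToFun; funToFin)
open import Data.Fin.Properties using (_≟_; suc-injective; all?; any?; finToFun-funToFin; funToFin-finToFin)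
open import Data.Fin.Subset using (_∈_; _⊆_; _∪_; ⁅_⁆; inside; outside)
open import Data.Fin.Subset.Properties using (_∈?_; x∈p∪q⁻; x∈p∪q⁺; x∈⁅x⁆; x∈⁅y⁆⇒x≡y; p⊆p∪q)
open import Data.Vec using ([]; _∷_; here; there; lookup; tabulate)
open import Data.Vec.Properties using (lookup∘tabulate; []=⇒lookup; lookup⇒[]=)
open import Data.Product using (∃; _,_; proj₁; proj₂)
open import Data.Sum using (inj₁; inj₂)
open import Function using (_∘_; id; _↔_; Inverse; Injection; mk↔ₛ′)
open import Function.Properties.Inverse using (↔⇒↣)
open import Relation.Nullary using (¬_; Dec; yes; no; contradiction)
open import Relation.Nullary.Decidable using (_×-dec_; _→-dec_; decidable-stable)
open import Relation.Nullary.Decidable.Core using (¬¬-excluded-middle)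
open import Relation.Nullary.Negation using (¬¬-map)
open import Relation.Binary.PropositionalEquality
  using (_≗_; refl; sym; trans; cong; cong₂; subst; subst₂; module ≡-Reasoning)
open import Algebra.Properties.Semiring.Sum +-*-semiring
  using (sum; sum-cong-≗; sum-replicate-zero; sum-permute; ∑-comm; *-distribˡ-sum; *-distribʳ-sum)

𝟙 : {A : Set} → Dec A → ℕ
𝟙 (yes _) = 1
𝟙 (no _)  = 0

𝟙-cong : {A B : Set} → (A → B) → (B → A) → (a? : Dec A) (b? : Dec B) → 𝟙 a? ≡ 𝟙 b?
𝟙-cong f g (yes a) (yes b) = refl
𝟙-cong f g (yes a) (no ¬b) = contradiction (f a) ¬b
𝟙-cong f g (no ¬a) (yes b) = contradiction (g b) ¬a
𝟙-cong f g (no _)  (no _)  = refl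

𝟙-yes : {A : Set} → A → (a? : Dec A) → 𝟙 a? ≡ 1
𝟙-yes a (yes _) = refl
𝟙-yes a (no ¬a) = contradiction a ¬a

𝟙-no : {A : Set} → ¬ A → (a? : Dec A) → 𝟙 a? ≡ 0
𝟙-no ¬a (yes a) = contradiction a ¬a
𝟙-no ¬a (no _)  = refl

𝟙-×-dec : {A B : Set} (a? : Dec A) (b? : Dec B) → 𝟙 (a? ×-dec b?) ≡ 𝟙 a? * 𝟙 b?
𝟙-×-dec (yes _) (yes _) = refl
𝟙-×-dec (yes _) (no _)  = refl
𝟙-×-dec (no _)  _       = refl

sum-const : ∀ n k → sum {n} (λ _ → k) ≡ n * k
sum-const zero    k = refl
sum-const (suc n) k = cong (k +_) (sum-const n k)

sum-mono-≤ : ∀ {n} {f g : Fin n → ℕ} → (∀ i → f i ≤ g i) → sum f ≤ sum g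
sum-mono-≤ {zero}  f≤g = z≤n
sum-mono-≤ {suc n} f≤g = +-mono-≤ (f≤g zero) (sum-mono-≤ (f≤g ∘ suc))

sum-mono-< : ∀ {n} {f g : Fin n → ℕ} → (∀ i → f i ≤ g i) → ∀ j → f j < g j → sum f < sum g
sum-mono-< f≤g zero    fj<gj = +-mono-<-≤ fj<gj (sum-mono-≤ (f≤g ∘ suc))
sum-mono-< f≤g (suc j) fj<gj = +-mono-≤-< (f≤g zero) (sum-mono-< (f≤g ∘ suc) j fj<gj)

term≤sum : ∀ {n} (f : Fin n → ℕ) j → f j ≤ sum f
term≤sum f zero    = m≤m+n _ _
term≤sum f (suc j) = ≤-trans (term≤sum (f ∘ suc) j) (m≤n+m _ _)

sum-𝟙-≟ : ∀ {n} (a : Fin n) (g : Fin n → ℕ) → sum (λ i → g i * 𝟙 (a ≟ i)) ≡ g a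
sum-𝟙-≟ {suc n} zero g = begin
  g zero * 1 + sum (λ i → g (suc i) * 𝟙 (zero ≟ suc i))
    ≡⟨ cong₂ _+_ (*-identityʳ _) (sum-cong-≗ tail≡0) ⟩
  g zero + sum {n} (λ _ → 0)
    ≡⟨ cong (g zero +_) (sum-replicate-zero n) ⟩
  g zero + 0
    ≡⟨ +-identityʳ _ ⟩
  g zero ∎
  where
  open ≡-Reasoning
  tail≡0 : ∀ i → g (suc i) * 𝟙 (zero ≟ suc i) ≡ 0
  tail≡0 i = trans (cong (g (suc i) *_) (𝟙-no (λ ()) (zero ≟ suc i))) (*-zeroʳ (g (suc i)))
sum-𝟙-≟ (suc a) g = begin
  g zero * 0 + sum (λ i → g (suc i) * 𝟙 (suc a ≟ suc i))
    ≡⟨ cong₂ _+_ (*-zeroʳ (g zero)) (sum-cong-≗ λ i →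
         cong (g (suc i) *_) (𝟙-cong suc-injective (cong suc) (suc a ≟ suc i) (a ≟ i))) ⟩
  sum (λ i → g (suc i) * 𝟙 (a ≟ i))
    ≡⟨ sum-𝟙-≟ a (g ∘ suc) ⟩
  g (suc a) ∎
  where open ≡-Reasoning

count : ∀ {n} {P : Fin n → Set} → (∀ i → Dec (P i)) → ℕ
count P? = sum (λ i → 𝟙 (P? i))

count≤1 : ∀ {n} {P : Fin n → Set} (P? : ∀ i → Dec (P i)) →
          (∀ {i j} → P i → P j → i ≡ j) → count P? ≤ 1
count≤1 {zero}  P? unique = z≤n
count≤1 {suc n} P? unique with P? zero
... | yes p₀ = s≤s (≤-reflexive (trans (sum-cong-≗ none) (sum-replicate-zero n)))
  where
  none : ∀ i → 𝟙 (P? (suc i)) ≡ 0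
  none i = 𝟙-no (λ p → contradiction (unique p₀ p) λ ()) (P? (suc i))
... | no _ = count≤1 (P? ∘ suc) (λ p q → suc-injective (unique p q))

count≥1 : ∀ {n} {P : Fin n → Set} (P? : ∀ i → Dec (P i)) → ∃ P → 1 ≤ count P?
count≥1 P? (i , p) = subst (_≤ count P?) (𝟙-yes p (P? i)) (term≤sum (λ j → 𝟙 (P? j)) i)

count≡0 : ∀ {n} {P : Fin n → Set} (P? : ∀ i → Dec (P i)) → (∀ i → ¬ P i) → count P? ≡ 0
count≡0 {n} P? none = trans (sum-cong-≗ (λ i → 𝟙-no (none i) (P? i))) (sum-replicate-zero n)

𝟙-∈-∷ : ∀ {n} x (p : Subset n) i → 𝟙 (i ∈? p) ≡ 𝟙 (suc i ∈? (x ∷ p))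
𝟙-∈-∷ x p i = 𝟙-cong there (λ { (there i∈p) → i∈p }) (i ∈? p) (suc i ∈? (x ∷ p))

∣p∣≡count∈ : ∀ {n} (p : Subset n) → ∣ p ∣ ≡ count (_∈? p)
∣p∣≡count∈ []            = refl
∣p∣≡count∈ (inside ∷ p)  = cong suc (trans (∣p∣≡count∈ p) (sum-cong-≗ (𝟙-∈-∷ inside p)))
∣p∣≡count∈ (outside ∷ p) = trans (∣p∣≡count∈ p) (sum-cong-≗ (𝟙-∈-∷ outside p))

𝟙*≤𝟙 : ∀ {A : Set} {m} (a? : Dec A) → (A → m ≤ 1) → 𝟙 a? * m ≤ 𝟙 a?
𝟙*≤𝟙 (yes a) m≤1 = ≤-trans (≤-reflexive (+-identityʳ _)) (m≤1 a)
𝟙*≤𝟙 (no _)  _   = z≤n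

𝟙*≡𝟙 : ∀ {A : Set} {m} (a? : Dec A) → (A → m ≡ 1) → 𝟙 a? * m ≡ 𝟙 a?
𝟙*≡𝟙 (yes a) m≡1 = trans (+-identityʳ _) (m≡1 a)
𝟙*≡𝟙 (no _)  _   = refl

sum-pull-weights : ∀ {p q r} (a : Fin p → Fin q → ℕ) (X : Fin r → Fin p → Fin q → ℕ) →
  sum (λ k → sum (λ c → sum (λ i → a c i * X k c i)))
    ≡ sum (λ c → sum (λ i → a c i * sum (λ k → X k c i)))
sum-pull-weights a X = begin
  sum (λ k → sum (λ c → sum (λ i → a c i * X k c i)))
    ≡⟨ ∑-comm (λ k c → sum (λ i → a c i * X k c i)) ⟩
  sum (λ c → sum (λ k → sum (λ i → a c i * X k c i)))
    ≡⟨ sum-cong-≗ (λ c → ∑-comm (λ k i → a c i * X k c i)) ⟩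
  sum (λ c → sum (λ i → sum (λ k → a c i * X k c i)))
    ≡⟨ sum-cong-≗ (λ c → sum-cong-≗ (λ i → *-distribˡ-sum (a c i) (λ k → X k c i))) ⟨
  sum (λ c → sum (λ i → a c i * sum (λ k → X k c i))) ∎
  where open ≡-Reasoning

sum-outer-product : ∀ {p q} (f : Fin p → ℕ) (g : Fin q → ℕ) (m : ℕ) →
  sum (λ c → sum (λ i → (f c * g i) * m)) ≡ sum f * sum g * m
sum-outer-product f g m = begin
  sum (λ c → sum (λ i → (f c * g i) * m))  ≡⟨ sum-cong-≗ (λ c → sum-cong-≗ (λ i → *-assoc (f c) (g i) m)) ⟩
  sum (λ c → sum (λ i → f c * (g i * m)))  ≡⟨ sum-cong-≗ (λ c → *-distribˡ-sum (f c) (λ i → g i * m)) ⟨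
  sum (λ c → f c * sum (λ i → g i * m))    ≡⟨ *-distribʳ-sum _ f ⟨
  sum f * sum (λ i → g i * m)              ≡⟨ cong (sum f *_) (*-distribʳ-sum m g) ⟨
  sum f * (sum g * m)                      ≡⟨ *-assoc (sum f) (sum g) m ⟨
  sum f * sum g * m                        ∎
  where open ≡-Reasoning

*-distribˡ-∑∑ : ∀ {p q} x (a d : Fin p → Fin q → ℕ) →
  x * sum (λ c → sum (λ i → a c i * d c i)) ≡ sum (λ c → sum (λ i → a c i * (x * d c i)))
*-distribˡ-∑∑ x a d = begin
  x * sum (λ c → sum (λ i → a c i * d c i))
    ≡⟨ *-distribˡ-sum x (λ c → sum (λ i → a c i * d c i)) ⟩
  sum (λ c → x * sum (λ i → a c i * d c i))
    ≡⟨ sum-cong-≗ (λ c → *-distribˡ-sum x (λ i → a c i * d c i)) ⟩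
  sum (λ c → sum (λ i → x * (a c i * d c i)))
    ≡⟨ sum-cong-≗ (λ c → sum-cong-≗ (λ i → swap x (a c i) (d c i))) ⟩
  sum (λ c → sum (λ i → a c i * (x * d c i))) ∎
  where
  open ≡-Reasoning
  swap : ∀ x y z → x * (y * z) ≡ y * (x * z)
  swap = solve-∀

funToFin-cong : ∀ {m n} {f g : Fin m → Fin n} → f ≗ g → funToFin f ≡ funToFin g
funToFin-cong {zero}  f≗g = refl
funToFin-cong {suc m} f≗g = cong₂ combine (f≗g zero) (funToFin-cong (f≗g ∘ suc))

module _ {m n : ℕ} where

  postcompose : (Fin n → Fin n) → Fin (n ^ m) → Fin (n ^ m)
  postcompose τ k = funToFin (τ ∘ finToFun {n} {m} k)

  postcompose-inverse : ∀ (τ τ′ : Fin n → Fin n) → τ ∘ τ′ ≗ id →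
                        ∀ k → postcompose τ (postcompose τ′ k) ≡ k
  postcompose-inverse τ τ′ ττ′≗id k = begin
    postcompose τ (postcompose τ′ k)        ≡⟨ funToFin-cong (cong τ ∘ finToFun-funToFin (τ′ ∘ finToFun {n} {m} k)) ⟩
    funToFin (τ ∘ τ′ ∘ finToFun {n} {m} k)  ≡⟨ funToFin-cong (ττ′≗id ∘ finToFun {n} {m} k) ⟩
    funToFin (finToFun {n} {m} k)           ≡⟨ funToFin-finToFin {m} k ⟩
    k                                       ∎
    where open ≡-Reasoning

  sum-postcompose : (σ : Fin n ↔ Fin n) (h : (Fin m → Fin n) → ℕ) → (∀ {f g} → f ≗ g → h f ≡ h g) →
                    sum (λ k → h (Inverse.to σ ∘ finToFun {n} {m} k)) ≡ sum (h ∘ finToFun)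
  sum-postcompose σ h h-cong =
    sym (trans (sum-permute (h ∘ finToFun) π)
               (sum-cong-≗ λ k → h-cong (finToFun-funToFin (to ∘ finToFun {n} {m} k))))
    where
    open Inverse σ
    π : Fin (n ^ m) ↔ Fin (n ^ m)
    π = mk↔ₛ′ (postcompose to) (postcompose from)
              (postcompose-inverse to from strictlyInverseˡ) (postcompose-inverse from to strictlyInverseʳ)

preimage : ∀ {m n} → (Fin m → Fin n) → Subset n → Subset m
preimage f p = tabulate (λ x → lookup p (f x))

∈-preimage⁺ : ∀ {m n} {f : Fin m → Fin n} {p x} → f x ∈ p → x ∈ preimage f p
∈-preimage⁺ {f = f} {p} {x} fx∈p = lookup⇒[]= x _ (trans (lookup∘tabulate _ x) ([]=⇒lookup fx∈p))

∈-preimage⁻ : ∀ {m n} {f : Fin m → Fin n} {p x} → x ∈ preimage f p → f x ∈ p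
∈-preimage⁻ {f = f} {p} {x} x∈f⁻¹p = lookup⇒[]= (f x) p (trans (sym (lookup∘tabulate _ x)) ([]=⇒lookup x∈f⁻¹p))

module _ {n : ℕ} (G : Graph n) where
  open Graph G using (Adj; irrefl) renaming (sym to Adj-sym)

  PreservesAdjacency : (Fin n → Fin n) → Set
  PreservesAdjacency f = ∀ u v → (Adj u v → Adj (f u) (f v)) × (Adj (f u) (f v) → Adj u v)

  -- Surjective maps of the finite vertex set are bijections, so these are the automorphisms;
  -- as plain maps they can be enumerated by the codes of Fin (n ^ n) (finToFun).
  IsAutomorphismMap : (Fin n → Fin n) → Set
  IsAutomorphismMap f = (∀ v → ∃ λ u → f u ≡ v) × PreservesAdjacency f

  id-isAutomorphismMap : IsAutomorphismMap id
  id-isAutomorphismMap = (λ v → v , refl) , λ u v → id , id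

  isAutomorphismMap-resp-≗ : ∀ {f g} → f ≗ g → IsAutomorphismMap f → IsAutomorphismMap g
  isAutomorphismMap-resp-≗ {f} {g} f≗g (surj , pres) =
    (λ v → let u , fu≡v = surj v in u , trans (sym (f≗g u)) fu≡v) ,
    λ u v → (λ uv → subst₂ Adj (f≗g u) (f≗g v) (proj₁ (pres u v) uv)) ,
            (λ guv → proj₂ (pres u v) (subst₂ Adj (sym (f≗g u)) (sym (f≗g v)) guv))

  module _ (σ : Fin n ↔ Fin n) (σ-aut : IsAutomorphism G σ) where
    open Inverse σ renaming (to to σ→; from to σ←)

    ∘-isAutomorphismMap : ∀ {f} → IsAutomorphismMap f → IsAutomorphismMap (σ→ ∘ f)
    ∘-isAutomorphismMap {f} (surj , pres) =
      (λ v → let u , fu≡σ←v = surj (σ← v) in u , trans (cong σ→ fu≡σ←v) (strictlyInverseˡ v)) ,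
      λ u v → proj₁ (σ-aut (f u) (f v)) ∘ proj₁ (pres u v) , proj₂ (pres u v) ∘ proj₂ (σ-aut (f u) (f v))

    ∘-isAutomorphismMap⁻ : ∀ {f} → IsAutomorphismMap (σ→ ∘ f) → IsAutomorphismMap f
    ∘-isAutomorphismMap⁻ {f} (surj , pres) =
      (λ v → let u , σfu≡σv = surj (σ→ v) in u , Injection.injective (↔⇒↣ σ) σfu≡σv) ,
      λ u v → proj₂ (σ-aut (f u) (f v)) ∘ proj₁ (pres u v) , proj₂ (pres u v) ∘ proj₁ (σ-aut (f u) (f v))

  meets-at-most-once : ∀ {f C I} → PreservesAdjacency f → IsClique G C → IsIndependent G I →
                       ∀ {c c′} → c ∈ C × f c ∈ I → c′ ∈ C × f c′ ∈ I → c ≡ c′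
  meets-at-most-once {f} pres C-clique I-indep {c} {c′} (c∈C , fc∈I) (c′∈C , fc′∈I) with c ≟ c′
  ... | yes c≡c′ = c≡c′
  ... | no  c≢c′ = contradiction (proj₁ (pres c c′) (C-clique c∈C c′∈C c≢c′)) (I-indep fc∈I fc′∈I)

  maximalIndependent-absorbs : ∀ {I v} → IsMaximalIndependent G I → (∀ {u} → u ∈ I → ¬ Adj u v) → v ∈ I
  maximalIndependent-absorbs {I} {v} (I-indep , I-max) I↛v =
    I-max (I ∪ ⁅ v ⁆) I∪v-indep (p⊆p∪q _) (x∈p∪q⁺ (inj₂ (x∈⁅x⁆ v)))
    where
    I∪v-indep : IsIndependent G (I ∪ ⁅ v ⁆)
    I∪v-indep {a} {b} a∈ b∈ with x∈p∪q⁻ I _ a∈ | x∈p∪q⁻ I _ b∈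
    ... | inj₁ a∈I | inj₁ b∈I = I-indep a∈I b∈I
    ... | inj₁ a∈I | inj₂ b∈v rewrite x∈⁅y⁆⇒x≡y v b∈v = I↛v a∈I
    ... | inj₂ a∈v | inj₁ b∈I rewrite x∈⁅y⁆⇒x≡y v a∈v = I↛v b∈I ∘ Adj-sym
    ... | inj₂ a∈v | inj₂ b∈v rewrite x∈⁅y⁆⇒x≡y v a∈v | x∈⁅y⁆⇒x≡y v b∈v = irrefl

  preimage-isMaximalIndependent : ∀ {f I} → IsAutomorphismMap f → IsMaximalIndependent G I →
                                  IsMaximalIndependent G (preimage f I)
  preimage-isMaximalIndependent {f} {I} (surj , pres) I-max@(I-indep , _) = f⁻¹I-indep , f⁻¹I-max
    where
    f⁻¹I-indep : IsIndependent G (preimage f I)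
    f⁻¹I-indep u∈ v∈ = I-indep (∈-preimage⁻ u∈) (∈-preimage⁻ v∈) ∘ proj₁ (pres _ _)

    f⁻¹I-max : ∀ J → IsIndependent G J → preimage f I ⊆ J → J ⊆ preimage f I
    f⁻¹I-max J J-indep f⁻¹I⊆J {v} v∈J = ∈-preimage⁺ (maximalIndependent-absorbs I-max fu↛fv)
      where
      fu↛fv : ∀ {w} → w ∈ I → ¬ Adj w (f v)
      fu↛fv {w} w∈I with surj w
      ... | u , refl = J-indep (f⁻¹I⊆J (∈-preimage⁺ w∈I)) v∈J ∘ proj₂ (pres u v)

  strongClique-meets-image : ∀ {f C I} → IsStrongClique G C → IsAutomorphismMap f → IsMaximalIndependent G I →
                             ∃ λ c → c ∈ C × f c ∈ I
  strongClique-meets-image (_ , meets) f-aut I-max with meets _ (preimage-isMaximalIndependent f-aut I-max)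
  ... | c , c∈C , c∈f⁻¹I = c , c∈C , ∈-preimage⁻ c∈f⁻¹I

module Counting {n : ℕ} (G : Graph n) (Adj? : ∀ u v → Dec (Graph.Adj G u v)) where
  open ≡-Reasoning

  isAutomorphismMap? : ∀ f → Dec (IsAutomorphismMap G f)
  isAutomorphismMap? f =
    all? (λ v → any? (λ u → f u ≟ v)) ×-dec
    all? (λ u → all? (λ v → (Adj? u v →-dec Adj? (f u) (f v)) ×-dec (Adj? (f u) (f v) →-dec Adj? u v)))

  𝟙aut-cong : ∀ {f g} → f ≗ g → 𝟙 (isAutomorphismMap? f) ≡ 𝟙 (isAutomorphismMap? g)
  𝟙aut-cong f≗g = 𝟙-cong (isAutomorphismMap-resp-≗ G f≗g) (isAutomorphismMap-resp-≗ G (sym ∘ f≗g)) _ _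

  endomap : Fin (n ^ n) → Fin n → Fin n
  endomap = finToFun

  aut : Fin (n ^ n) → ℕ
  aut k = 𝟙 (isAutomorphismMap? (endomap k))

  #Aut : ℕ
  #Aut = sum aut

  #Aut[_↦_] : Fin n → Fin n → ℕ
  #Aut[ c ↦ i ] = sum (λ k → aut k * 𝟙 (endomap k c ≟ i))

  -- Postcomposing with an automorphism σ taking c to i permutes the automorphisms and turns
  -- those fixing c into those sending c to i.
  #Aut[↦]-uniform : IsVertexTransitive G → ∀ c i → #Aut[ c ↦ i ] ≡ #Aut[ c ↦ c ]
  #Aut[↦]-uniform vt c i with vt c i
  ... | σ , σ-aut , refl = begin
    sum (λ k → h (endomap k))       ≡⟨ sum-postcompose σ h h-cong ⟨
    sum (λ k → h (σ→ ∘ endomap k))  ≡⟨ sum-cong-≗ (λ k → cong₂ _*_ (aut-invariant k) (maps-c-to-σc k)) ⟩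
    #Aut[ c ↦ c ]                   ∎
    where
    open Inverse σ renaming (to to σ→)
    h : (Fin n → Fin n) → ℕ
    h f = 𝟙 (isAutomorphismMap? f) * 𝟙 (f c ≟ σ→ c)
    h-cong : ∀ {f g} → f ≗ g → h f ≡ h g
    h-cong f≗g = cong₂ _*_ (𝟙aut-cong f≗g) (𝟙-cong (trans (sym (f≗g c))) (trans (f≗g c)) _ _)
    aut-invariant : ∀ k → 𝟙 (isAutomorphismMap? (σ→ ∘ endomap k)) ≡ aut k
    aut-invariant k = 𝟙-cong (∘-isAutomorphismMap⁻ G σ σ-aut) (∘-isAutomorphismMap G σ σ-aut) _ _
    maps-c-to-σc : ∀ k → 𝟙 (σ→ (endomap k c) ≟ σ→ c) ≡ 𝟙 (endomap k c ≟ c)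
    maps-c-to-σc k = 𝟙-cong (Injection.injective (↔⇒↣ σ)) (cong σ→) _ _

  sum-#Aut[↦] : ∀ c → sum (λ i → #Aut[ c ↦ i ]) ≡ #Aut
  sum-#Aut[↦] c = begin
    sum (λ i → sum (λ k → aut k * 𝟙 (endomap k c ≟ i)))  ≡⟨ ∑-comm (λ i k → aut k * 𝟙 (endomap k c ≟ i)) ⟩
    sum (λ k → sum (λ i → aut k * 𝟙 (endomap k c ≟ i)))  ≡⟨ sum-cong-≗ (λ k → sum-𝟙-≟ (endomap k c) (λ _ → aut k)) ⟩
    #Aut                                                 ∎

  n*#Aut[↦] : IsVertexTransitive G → ∀ c i → n * #Aut[ c ↦ i ] ≡ #Aut
  n*#Aut[↦] vt c i = begin
    n * #Aut[ c ↦ i ]                    ≡⟨ cong (n *_) (#Aut[↦]-uniform vt c i) ⟩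
    n * #Aut[ c ↦ c ]                    ≡⟨ sum-const n _ ⟨
    sum (λ (j : Fin n) → #Aut[ c ↦ c ])  ≡⟨ sum-cong-≗ (sym ∘ #Aut[↦]-uniform vt c) ⟩
    sum (λ j → #Aut[ c ↦ j ])            ≡⟨ sum-#Aut[↦] c ⟩
    #Aut                                 ∎

  idIndex : Fin (n ^ n)
  idIndex = funToFin {n} id

  endomap-idIndex : endomap idIndex ≗ id
  endomap-idIndex = finToFun-funToFin id

  aut-idIndex : aut idIndex ≡ 1
  aut-idIndex = 𝟙-yes (isAutomorphismMap-resp-≗ G (sym ∘ endomap-idIndex) (id-isAutomorphismMap G)) _

  1≤#Aut : 1 ≤ #Aut
  1≤#Aut = subst (_≤ #Aut) aut-idIndex (term≤sum aut idIndex)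

  module _ (C I : Subset n) where

    hits : (Fin n → Fin n) → ℕ
    hits f = count (λ c → (c ∈? C) ×-dec (f c ∈? I))

    in-C×I : Fin n → Fin n → ℕ
    in-C×I c i = 𝟙 (c ∈? C) * 𝟙 (i ∈? I)

    hits-expand : ∀ f → hits f ≡ sum (λ c → sum (λ i → in-C×I c i * 𝟙 (f c ≟ i)))
    hits-expand f = sum-cong-≗ λ c → begin
      𝟙 ((c ∈? C) ×-dec (f c ∈? I))                          ≡⟨ 𝟙-×-dec (c ∈? C) (f c ∈? I) ⟩
      𝟙 (c ∈? C) * 𝟙 (f c ∈? I)                              ≡⟨ cong (𝟙 (c ∈? C) *_) (sum-𝟙-≟ (f c) χI) ⟨
      𝟙 (c ∈? C) * sum (λ i → χI i * 𝟙 (f c ≟ i))            ≡⟨ *-distribˡ-sum (𝟙 (c ∈? C)) (λ i → χI i * 𝟙 (f c ≟ i)) ⟩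
      sum (λ i → 𝟙 (c ∈? C) * (χI i * 𝟙 (f c ≟ i)))          ≡⟨ sum-cong-≗ (λ i → *-assoc (𝟙 (c ∈? C)) (χI i) _) ⟨
      sum (λ i → in-C×I c i * 𝟙 (f c ≟ i))                   ∎
      where
      χI : Fin n → ℕ
      χI i = 𝟙 (i ∈? I)

    double-count : IsVertexTransitive G → n * sum (λ k → aut k * hits (endomap k)) ≡ ∣ C ∣ * ∣ I ∣ * #Aut
    double-count vt = begin
      n * sum (λ k → aut k * hits (endomap k))
        ≡⟨ cong (n *_) (sum-cong-≗ λ k →
             trans (cong (aut k *_) (hits-expand (endomap k))) (*-distribˡ-∑∑ (aut k) in-C×I _)) ⟩
      n * sum (λ k → sum (λ c → sum (λ i → in-C×I c i * (aut k * 𝟙 (endomap k c ≟ i)))))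
        ≡⟨ cong (n *_) (sum-pull-weights in-C×I (λ k c i → aut k * 𝟙 (endomap k c ≟ i))) ⟩
      n * sum (λ c → sum (λ i → in-C×I c i * #Aut[ c ↦ i ]))
        ≡⟨ *-distribˡ-∑∑ n in-C×I #Aut[_↦_] ⟩
      sum (λ c → sum (λ i → in-C×I c i * (n * #Aut[ c ↦ i ])))
        ≡⟨ sum-cong-≗ (λ c → sum-cong-≗ (λ i → cong (in-C×I c i *_) (n*#Aut[↦] vt c i))) ⟩
      sum (λ c → sum (λ i → in-C×I c i * #Aut))
        ≡⟨ sum-outer-product (λ c → 𝟙 (c ∈? C)) (λ i → 𝟙 (i ∈? I)) #Aut ⟩
      count (_∈? C) * count (_∈? I) * #Aut
        ≡⟨ cong₂ (λ x y → x * y * #Aut) (∣p∣≡count∈ C) (∣p∣≡count∈ I) ⟨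
      ∣ C ∣ * ∣ I ∣ * #Aut ∎

    aut*hits≤aut : IsClique G C → IsIndependent G I → ∀ k → aut k * hits (endomap k) ≤ aut k
    aut*hits≤aut C-clique I-indep k = 𝟙*≤𝟙 (isAutomorphismMap? (endomap k)) λ (_ , pres) →
      count≤1 _ (meets-at-most-once G pres C-clique I-indep)

    aut*hits≡aut : IsStrongClique G C → IsMaximalIndependent G I → ∀ k → aut k * hits (endomap k) ≡ aut k
    aut*hits≡aut C-strong@(C-clique , _) I-max@(I-indep , _) k =
      𝟙*≡𝟙 (isAutomorphismMap? (endomap k)) λ f-aut →
        ≤-antisym (count≤1 _ (meets-at-most-once G (proj₂ f-aut) C-clique I-indep))
                  (count≥1 _ (strongClique-meets-image G C-strong f-aut I-max))

    strong⇒∣C∣*∣I∣≡n : IsVertexTransitive G → IsStrongClique G C → IsMaximalIndependent G I →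
                       ∣ C ∣ * ∣ I ∣ ≡ n
    strong⇒∣C∣*∣I∣≡n vt C-strong I-max = *-cancelʳ-≡ _ _ #Aut {{>-nonZero 1≤#Aut}} (begin
      ∣ C ∣ * ∣ I ∣ * #Aut                     ≡⟨ double-count vt ⟨
      n * sum (λ k → aut k * hits (endomap k))  ≡⟨ cong (n *_) (sum-cong-≗ (aut*hits≡aut C-strong I-max)) ⟩
      n * #Aut                                  ∎)

    ∣C∣*∣I∣≡n⇒C-meets-I : .{{NonZero n}} → IsVertexTransitive G → IsClique G C → IsIndependent G I →
                     ∣ C ∣ * ∣ I ∣ ≡ n → ∃ λ c → c ∈ C × c ∈ I
    ∣C∣*∣I∣≡n⇒C-meets-I vt C-clique I-indep |C||I|≡n with any? (λ c → (c ∈? C) ×-dec (c ∈? I))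
    ... | yes meet  = meet
    ... | no  ¬meet = contradiction weighted-sum≡#Aut (<⇒≢ weighted-sum<#Aut)
      where
      weighted-sum≡#Aut : sum (λ k → aut k * hits (endomap k)) ≡ #Aut
      weighted-sum≡#Aut = *-cancelˡ-≡ _ _ n (trans (double-count vt) (cong (_* #Aut) |C||I|≡n))

      hits-id≡0 : hits (endomap idIndex) ≡ 0
      hits-id≡0 = count≡0 (λ c → (c ∈? C) ×-dec (endomap idIndex c ∈? I)) λ c (c∈C , c∈I) →
        ¬meet (c , c∈C , subst (_∈ I) (endomap-idIndex c) c∈I)

      weighted-sum<#Aut : sum (λ k → aut k * hits (endomap k)) < #Aut
      weighted-sum<#Aut = sum-mono-< (aut*hits≤aut C-clique I-indep) idIndex
        (subst₂ (λ a m → a * m < a) (sym aut-idIndex) (sym hits-id≡0) (s≤s z≤n))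

¬¬-∀-Fin : ∀ {n} {P : Fin n → Set} → (∀ i → ¬ ¬ P i) → ¬ ¬ (∀ i → P i)
¬¬-∀-Fin {zero}  ¬¬P ¬∀P = ¬∀P λ ()
¬¬-∀-Fin {suc n} ¬¬P ¬∀P = ¬¬P zero λ P₀ → ¬¬-∀-Fin (λ i → ¬¬P (suc i)) λ P₊ →
  ¬∀P λ { zero → P₀ ; (suc i) → P₊ i }

-- Excluded middle for the finitely many adjacencies holds under double negation,
-- which a decidable goal can discharge.
assuming-decidable-adjacency : ∀ {n} (G : Graph n) {P : Set} → Dec P →
                               ((∀ u v → Dec (Graph.Adj G u v)) → P) → P
assuming-decidable-adjacency G P? prove = decidable-stable P? (¬¬-map prove ¬¬-decidable)
  where
  ¬¬-decidable : ¬ ¬ (∀ u v → Dec (Graph.Adj G u v))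
  ¬¬-decidable = ¬¬-∀-Fin λ u → ¬¬-∀-Fin λ v → ¬¬-excluded-middle

theorem3p1 : ∀ {n : ℕ} .{{_ : NonZero n}} (G : Graph n) → IsVertexTransitive G →
    (C : Subset n) → IsClique G C →
    (IsStrongClique G C → ∀ I → IsMaximalIndependent G I → ∣ C ∣ * ∣ I ∣ ≡ n)
    × ((∀ I → IsMaximalIndependent G I → ∣ C ∣ * ∣ I ∣ ≡ n) → IsStrongClique G C)
theorem3p1 {n} G vt C C-clique = strong⇒product , product⇒strong
  where
  open Counting G

  strong⇒product : IsStrongClique G C → ∀ I → IsMaximalIndependent G I → ∣ C ∣ * ∣ I ∣ ≡ n
  strong⇒product C-strong I I-max = assuming-decidable-adjacency G (∣ C ∣ * ∣ I ∣ ≟ℕ n) λ Adj? →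
    strong⇒∣C∣*∣I∣≡n Adj? C I vt C-strong I-max

  product⇒strong : (∀ I → IsMaximalIndependent G I → ∣ C ∣ * ∣ I ∣ ≡ n) → IsStrongClique G C
  product⇒strong product≡n = C-clique , λ I I-max@(I-indep , _) →
    assuming-decidable-adjacency G (any? λ c → (c ∈? C) ×-dec (c ∈? I)) λ Adj? →
      ∣C∣*∣I∣≡n⇒C-meets-I Adj? C I vt C-clique I-indep (product≡n I I-max)
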